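{- For every positive integer $n$, $C_{\rm Sp}(M(T_n))\ge\sqrt[n]{n^n+1}>n$, where $T_n$ is the transitive tournament on $n$ vertices.
   Context: $T_n$ is the digraph on vertices $1,\dots,n$ with $(i,j)$ an edge iff $i<j$. The Mycielskian $M(D)$ of a digraph $D$ has vertex set $V(D)\times\{0,1\}\cup\{z\}$ and edge set $\{((v,0),(w,i)):(v,w)\in E(D),\ i\in\{0,1\}\}\cup\{((v,1),(w,0)):(v,w)\in E(D)\}\cup\{(z,(v,1)):v\in V(D)\}$. For a digraph $H$, $H^t$ is its $t$-fold OR-power (vertex set $V(H)^t$, a directed edge from $(a_j)$ to $(b_j)$ iff $(a_j,b_j)\in E(H)$ for some $j$); $\omega_{\rm tr}(H)$ is the largest $m$ with distinct vertices $q_1,\dots,q_m$ such that $(q_i,q_j)\in E(H)$ for all $i<j$; and $C_{\rm Sp}(H)=\lim_{t\to\infty}\sqrt[t]{\omega_{\rm tr}(H^t)}$. -}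

module Defs where

open import Data.Nat using (ℕ; _+_; _*_; _^_; _≤_; _<_)
open import Data.Fin using (Fin)
import Data.Fin as F
open import Data.Bool using (Bool; true; false)
open import Data.Product using (Σ; ∃; _×_)
open import Function.Definitions using (Injective)
open import Relation.Binary.PropositionalEquality using (_≡_)
open import Level using (0ℓ) renaming (suc to lsuc)

record Digraph : Set₁ where
  field
    V : Set
    E : V → V → Set
open Digraph public

T : ℕ → Digraph
T n = record { V = Fin n ; E = λ i j → i F.< j }

-- Vertices of the Mycielskian: (v,0) = ⟨ v , false ⟩, (v,1) = ⟨ v , true ⟩, and z.
data MV (D : Digraph) : Set where
  ⟨_,_⟩ : V D → Bool → MV D
  z     : MV D

data MEdge (D : Digraph) : MV D → MV D → Set where
  e0i : ∀ {v w} (i : Bool) → E D v w → MEdge D ⟨ v , false ⟩ ⟨ w , i ⟩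
  e10 : ∀ {v w} → E D v w → MEdge D ⟨ v , true ⟩ ⟨ w , false ⟩
  ez  : ∀ v → MEdge D z ⟨ v , true ⟩

Mycielskian : Digraph → Digraph
Mycielskian D = record { V = MV D ; E = MEdge D }

OrPower : Digraph → ℕ → Digraph
OrPower H t = record { V = Fin t → V H ; E = λ a b → ∃ λ (j : Fin t) → E H (a j) (b j) }

HasTransClique : Digraph → ℕ → Set
HasTransClique H m =
  Σ (Fin m → V H) λ q → Injective _≡_ _≡_ q × (∀ i j → i F.< j → E H (q i) (q j))

-- "C_Sp(H) ≥ (c)^(1/n)" for c a natural number, phrased without reals:
-- for every positive rational a/b below c^(1/n) (i.e. a^n < c * b^n),
-- eventually ω_tr(H^t) ≥ (a/b)^t, i.e. H^t has a transitive clique of size m with a^t ≤ m * b^t.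
CSpAtLeastRoot : Digraph → ℕ → ℕ → Set
CSpAtLeastRoot H c n =
  ∀ (a b : ℕ) → 0 < b → a ^ n < c * b ^ n →
    ∃ λ (T₀ : ℕ) → ∀ t → T₀ ≤ t →
      ∃ λ (m : ℕ) → HasTransClique (OrPower H t) m × a ^ t ≤ m * b ^ t

{-# OPTIONS --safe #-}
-- A tuple p ∈ {0,…,n-1}^n with apex a(p) := (Σ p) mod n becomes the vertex of M(T_n)^n that is
-- (p_k,1) at k = a(p) and (p_k,0) elsewhere. Sort the tuples by Σ p and then by decreasing
-- p_{a(p)}: each has an edge to every later one in some coordinate, since otherwise the later one
-- is dominated everywhere except possibly at a common apex, which forces equal sums (they agree
-- mod n and differ by less than n) and then equal tuples. Headed by z^n this is a transitive
-- clique of size n^n + 1 in M(T_n)^n; lexicographic products of its powers give cliques of size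
-- (n^n + 1)^⌊t/n⌋ in M(T_n)^t, which eventually exceed (a/b)^t whenever a^n < (n^n + 1) b^n.
module Submission where

open import Defs
open import Data.Nat using (ℕ; zero; suc; _+_; _*_; _^_; _≤_; _<_; z≤n; s≤s; z<s; NonZero)
open import Data.Nat.Properties
open import Data.Nat.DivMod using (_%_; _/_; _mod_; m≡m%n+[m/n]*n; m%n<n; m*n/n≡m; /-monoˡ-≤)
open import Data.Nat.Solver using (module +-*-Solver)
open import Data.Fin as F using (Fin; toℕ; _↑ˡ_; _↑ʳ_)
import Data.Fin.Properties as FP
open import Data.Vec.Functional using (Vector; _++_)
open import Data.Vec.Functional.Properties using (lookup-++ˡ; lookup-++ʳ)
open import Data.Product using (Σ; ∃; _×_; _,_)
open import Data.Sum using (_⊎_; inj₁; inj₂; [_,_])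
open import Data.Empty using (⊥-elim)
open import Data.List using (List; length; lookup; allFin)
import Data.List.Properties as List
open import Data.List.Membership.Propositional.Properties using (∈-lookup)
open import Data.List.Relation.Unary.All as All using ()
open import Data.List.Relation.Unary.AllPairs as AllPairs using (AllPairs; _∷_)
open import Data.List.Relation.Unary.Unique.Propositional.Properties using (allFin⁺)
open import Data.List.Relation.Binary.Permutation.Propositional using (↭-sym; ↭⇒↭ₛ)
open import Data.List.Relation.Binary.Permutation.Propositional.Properties using (↭-length)
import Data.List.Relation.Binary.Permutation.Setoid.Properties as Permutation
import Data.List.Relation.Unary.Sorted.TotalOrder.Properties as Sorted
import Data.List.Sort as Sort
open import Data.Product.Relation.Binary.Lex.NonStrict using (×-decTotalOrder)
open import Function using (_∘_)
open import Function.Definitions using (Injective)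
open import Algebra.Properties.Monoid.Sum +-0-monoid using (sum)
open import Relation.Nullary using (¬_; Dec; yes; no; does)
open import Relation.Nullary.Decidable using (_×-dec_; _⊎-dec_; ¬?)
open import Relation.Binary.Bundles using (DecTotalOrder)
open import Relation.Binary.Definitions using (tri<; tri≈; tri>)
import Relation.Binary.Construct.Flip.EqAndOrd as Flip
import Relation.Binary.Construct.On as On
open import Relation.Binary.PropositionalEquality hiding ([_])

≡-mod⇒≡ : ∀ {a b} n .{{_ : NonZero n}} → a ≤ b → b < a + n → a % n ≡ b % n → a ≡ b
≡-mod⇒≡ {a} {b} n a≤b b<a+n a%n≡b%n = begin-equality
  a               ≡⟨ a≡r+[a/n]*n ⟩
  r + (a / n) * n ≡⟨ cong (λ q → r + q * n) a/n≡b/n ⟩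
  r + (b / n) * n ≡⟨ m≡m%n+[m/n]*n b n ⟨
  b               ∎
  where
  open ≤-Reasoning
  r : ℕ
  r = b % n
  a≡r+[a/n]*n : a ≡ r + (a / n) * n
  a≡r+[a/n]*n = trans (m≡m%n+[m/n]*n a n) (cong (_+ (a / n) * n) a%n≡b%n)
  b/n<1+a/n : b / n < suc (a / n)
  b/n<1+a/n = *-cancelʳ-< _ (b / n) (suc (a / n)) (+-cancelˡ-< r _ _ (begin-strict
    r + (b / n) * n       ≡⟨ m≡m%n+[m/n]*n b n ⟨
    b                     <⟨ b<a+n ⟩
    a + n                 ≡⟨ cong (_+ n) a≡r+[a/n]*n ⟩
    r + (a / n) * n + n   ≡⟨ +-assoc r _ n ⟩
    r + ((a / n) * n + n) ≡⟨ cong (r +_) (+-comm _ n) ⟩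
    r + suc (a / n) * n   ∎))
  a/n≡b/n : a / n ≡ b / n
  a/n≡b/n = ≤-antisym (/-monoˡ-≤ n a≤b) (≤-pred b/n<1+a/n)

sum-mono-≤ : ∀ {k} {f g : Vector ℕ k} → (∀ i → f i ≤ g i) → sum f ≤ sum g
sum-mono-≤ {zero}  f≤g = z≤n
sum-mono-≤ {suc k} f≤g = +-mono-≤ (f≤g F.zero) (sum-mono-≤ (f≤g ∘ F.suc))

pointwise-≤∧sum-≥⇒≗ : ∀ {k} {f g : Vector ℕ k} → (∀ i → f i ≤ g i) → sum g ≤ sum f → ∀ i → f i ≡ g i
pointwise-≤∧sum-≥⇒≗ {suc k} {f} {g} f≤g Σg≤Σf i with m≤n⇒m<n∨m≡n (f≤g F.zero)
... | inj₁ f₀<g₀ = ⊥-elim (<⇒≱ (+-mono-<-≤ f₀<g₀ (sum-mono-≤ (f≤g ∘ F.suc))) Σg≤Σf)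
... | inj₂ f₀≡g₀ with i
...   | F.zero  = f₀≡g₀
...   | F.suc i = pointwise-≤∧sum-≥⇒≗ (f≤g ∘ F.suc) Σg′≤Σf′ i
  where
  Σg′≤Σf′ : sum (g ∘ F.suc) ≤ sum (f ∘ F.suc)
  Σg′≤Σf′ = +-cancelˡ-≤ (g F.zero) _ _ (subst (λ x → g F.zero + _ ≤ x + _) f₀≡g₀ Σg≤Σf)

sum-mono-≤-except : ∀ {k} {f g : Vector ℕ k} j → (∀ i → i ≢ j → f i ≤ g i) →
                    sum f + g j ≤ sum g + f j
sum-mono-≤-except {suc k} {f} {g} F.zero f≤g = begin
  f F.zero + sum f′ + g F.zero   ≡⟨ +-comm (f F.zero + sum f′) (g F.zero) ⟩
  g F.zero + (f F.zero + sum f′) ≤⟨ +-monoʳ-≤ (g F.zero) (+-monoʳ-≤ (f F.zero) (sum-mono-≤ λ i → f≤g (F.suc i) λ ())) ⟩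
  g F.zero + (f F.zero + sum g′) ≡⟨ cong (g F.zero +_) (+-comm (f F.zero) (sum g′)) ⟩
  g F.zero + (sum g′ + f F.zero) ≡⟨ +-assoc (g F.zero) (sum g′) (f F.zero) ⟨
  g F.zero + sum g′ + f F.zero   ∎
  where
  open ≤-Reasoning
  f′ g′ : Vector ℕ k
  f′ = f ∘ F.suc
  g′ = g ∘ F.suc
sum-mono-≤-except {suc k} {f} {g} (F.suc j) f≤g = begin
  f F.zero + sum f′ + g (F.suc j)   ≡⟨ +-assoc (f F.zero) (sum f′) (g (F.suc j)) ⟩
  f F.zero + (sum f′ + g (F.suc j)) ≤⟨ +-mono-≤ (f≤g F.zero λ ()) (sum-mono-≤-except j λ i i≢j → f≤g (F.suc i) (i≢j ∘ FP.suc-injective)) ⟩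
  g F.zero + (sum g′ + f (F.suc j)) ≡⟨ +-assoc (g F.zero) (sum g′) (f (F.suc j)) ⟨
  g F.zero + sum g′ + f (F.suc j)   ∎
  where
  open ≤-Reasoning
  f′ g′ : Vector ℕ k
  f′ = f ∘ F.suc
  g′ = g ∘ F.suc

[m*n]^o≡m^o*n^o : ∀ m n o → (m * n) ^ o ≡ m ^ o * n ^ o
[m*n]^o≡m^o*n^o m n zero    = refl
[m*n]^o≡m^o*n^o m n (suc o) = begin
  m * n * (m * n) ^ o     ≡⟨ cong (m * n *_) ([m*n]^o≡m^o*n^o m n o) ⟩
  m * n * (m ^ o * n ^ o) ≡⟨ solve 4 (λ m n x y → (m :* n) :* (x :* y) := (m :* x) :* (n :* y)) refl m n (m ^ o) (n ^ o) ⟩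
  m * m ^ o * (n * n ^ o) ∎
  where
  open ≡-Reasoning
  open +-*-Solver

-- Bernoulli's inequality (1 + 1/m)^n ≥ 1 + n/m, cleared of denominators.
m^n*[m+n]≤m*[1+m]^n : ∀ m n → m ^ n * (m + n) ≤ m * suc m ^ n
m^n*[m+n]≤m*[1+m]^n m zero    = ≤-reflexive (trans (+-identityʳ (m + 0)) (trans (+-identityʳ m) (sym (*-identityʳ m))))
m^n*[m+n]≤m*[1+m]^n m (suc n) = begin
  m * m ^ n * (m + suc n)         ≡⟨ solve 3 (λ m x n → m :* x :* (m :+ (con 1 :+ n)) := m :* (x :* (m :+ n)) :+ m :* x) refl m (m ^ n) n ⟩
  m * (m ^ n * (m + n)) + m * m ^ n ≤⟨ +-mono-≤ (*-monoʳ-≤ m (m^n*[m+n]≤m*[1+m]^n m n)) (*-monoʳ-≤ m (^-monoˡ-≤ n (n≤1+n m))) ⟩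
  m * (m * suc m ^ n) + m * suc m ^ n ≡⟨ solve 2 (λ m y → m :* (m :* y) :+ m :* y := m :* ((con 1 :+ m) :* y)) refl m (suc m ^ n) ⟩
  m * (suc m * suc m ^ n)         ∎
  where
  open ≤-Reasoning
  open +-*-Solver

m<n∧m*k<s⇒m^s*k≤n^s : ∀ {m n k s} → m < n → m * k < s → m ^ s * k ≤ n ^ s
m<n∧m*k<s⇒m^s*k≤n^s {zero}  {s = suc s} _ _ = z≤n
m<n∧m*k<s⇒m^s*k≤n^s {suc m} {n} {k} {s} m<n mk<s = *-cancelˡ-≤ (suc m) (begin
  suc m * (suc m ^ s * k) ≡⟨ solve 3 (λ m x k → m :* (x :* k) := x :* (m :* k)) refl (suc m) (suc m ^ s) k ⟩
  suc m ^ s * (suc m * k) ≤⟨ *-monoʳ-≤ (suc m ^ s) (≤-trans (<⇒≤ mk<s) (m≤n+m s (suc m))) ⟩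
  suc m ^ s * (suc m + s) ≤⟨ m^n*[m+n]≤m*[1+m]^n (suc m) s ⟩
  suc m * suc (suc m) ^ s ≤⟨ *-monoʳ-≤ (suc m) (^-monoˡ-≤ s m<n) ⟩
  suc m * n ^ s           ∎)
  where
  open ≤-Reasoning
  open +-*-Solver

a^t≤c^[t/n]*b^t : ∀ n .{{_ : NonZero n}} {a b c t} .{{_ : NonZero b}} →
                  a ^ n < c * b ^ n → a ^ n * suc a ^ n < t / n → a ^ t ≤ c ^ (t / n) * b ^ t
a^t≤c^[t/n]*b^t n {a} {b} {c} {t} aⁿ<cbⁿ bound = begin
  a ^ t                         ≡⟨ cong (a ^_) t≡s*n+r ⟩
  a ^ (s * n + r)               ≡⟨ ^-distribˡ-+-* a (s * n) r ⟩
  a ^ (s * n) * a ^ r           ≡⟨ cong (_* a ^ r) (^[s*n]≡[^n]^s a) ⟩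
  (a ^ n) ^ s * a ^ r           ≤⟨ *-monoʳ-≤ ((a ^ n) ^ s) a^r≤[1+a]^n ⟩
  (a ^ n) ^ s * suc a ^ n       ≤⟨ m<n∧m*k<s⇒m^s*k≤n^s aⁿ<cbⁿ bound ⟩
  (c * b ^ n) ^ s               ≡⟨ [m*n]^o≡m^o*n^o c (b ^ n) s ⟩
  c ^ s * (b ^ n) ^ s           ≡⟨ cong (c ^ s *_) (^[s*n]≡[^n]^s b) ⟨
  c ^ s * b ^ (s * n)           ≤⟨ m≤m*n (c ^ s * b ^ (s * n)) (b ^ r) {{m^n≢0 b r}} ⟩
  c ^ s * b ^ (s * n) * b ^ r   ≡⟨ *-assoc (c ^ s) (b ^ (s * n)) (b ^ r) ⟩
  c ^ s * (b ^ (s * n) * b ^ r) ≡⟨ cong (c ^ s *_) (^-distribˡ-+-* b (s * n) r) ⟨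
  c ^ s * b ^ (s * n + r)       ≡⟨ cong (λ u → c ^ s * b ^ u) t≡s*n+r ⟨
  c ^ s * b ^ t                 ∎
  where
  open ≤-Reasoning
  s r : ℕ
  s = t / n
  r = t % n
  t≡s*n+r : t ≡ s * n + r
  t≡s*n+r = trans (m≡m%n+[m/n]*n t n) (+-comm r (s * n))
  ^[s*n]≡[^n]^s : ∀ x → x ^ (s * n) ≡ (x ^ n) ^ s
  ^[s*n]≡[^n]^s x = trans (cong (x ^_) (*-comm s n)) (sym (^-*-assoc x n s))
  a^r≤[1+a]^n : a ^ r ≤ suc a ^ n
  a^r≤[1+a]^n = ≤-trans (^-monoˡ-≤ r (n≤1+n a)) (^-monoʳ-≤ (suc a) (<⇒≤ (m%n<n t n)))

AllPairs-lookup : ∀ {a r} {A : Set a} {R : A → A → Set r} {xs : List A} → AllPairs R xs →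
                  ∀ {i j} → i F.< j → R (lookup xs i) (lookup xs j)
AllPairs-lookup (Rx ∷ _)   {F.zero}  {F.suc j} _         = All.lookup Rx (∈-lookup j)
AllPairs-lookup (_ ∷ Rxs) {F.suc i} {F.suc j} (s≤s i<j) = AllPairs-lookup Rxs i<j

module SortedEnumeration {a ℓ₁ ℓ₂} (O : DecTotalOrder a ℓ₁ ℓ₂) {N : ℕ}
                         (h : Fin N → DecTotalOrder.Carrier O) where
  open DecTotalOrder O using () renaming (_≤_ to _≼_)

  private
    open Sort (On.decTotalOrder O h) using (sort; sort-↭; sort-↗)

    xs : List (Fin N)
    xs = sort (allFin N)

    |xs|≡N : length xs ≡ N
    |xs|≡N = trans (↭-length (sort-↭ (allFin N))) (List.length-tabulate (λ i → i))

    distinct-sorted : AllPairs (λ x y → x ≢ y × h x ≼ h y) xs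
    distinct-sorted = AllPairs.zip
      ( Permutation.Unique-resp-↭ (setoid (Fin N)) (↭⇒↭ₛ (↭-sym (sort-↭ (allFin N)))) (allFin⁺ N)
      , Sorted.Sorted⇒AllPairs (DecTotalOrder.totalOrder (On.decTotalOrder O h)) (sort-↗ (allFin N)) )

  enumerate : Fin N → Fin N
  enumerate i = lookup xs (F.cast (sym |xs|≡N) i)

  enumerate-sorted : ∀ {i j} → i F.< j → enumerate i ≢ enumerate j × h (enumerate i) ≼ h (enumerate j)
  enumerate-sorted {i} {j} i<j = AllPairs-lookup distinct-sorted
    (subst₂ _<_ (sym (FP.toℕ-cast (sym |xs|≡N) i)) (sym (FP.toℕ-cast (sym |xs|≡N) j)) i<j)

TransChain : Digraph → ℕ → Set
TransChain H m = Σ (Fin m → V H) λ q → ∀ i j → i F.< j → E H (q i) (q j)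

Loopless : Digraph → Set
Loopless H = ∀ {v} → ¬ E H v v

chain⇒transClique : ∀ {H m} → Loopless H → TransChain H m → HasTransClique H m
chain⇒transClique {H} loopless (q , edge) = q , injective , edge
  where
  injective : Injective _≡_ _≡_ q
  injective {i} {j} qi≡qj with FP.<-cmp i j
  ... | tri< i<j _ _ = ⊥-elim (loopless (subst (E H (q i)) (sym qi≡qj) (edge i j i<j)))
  ... | tri≈ _ i≡j _ = i≡j
  ... | tri> _ _ j<i = ⊥-elim (loopless (subst (E H (q j)) qi≡qj (edge j i j<i)))

chain-cons : ∀ {H k} (u : V H) ((q , edge) : TransChain H k) → (∀ i → E H u (q i)) → TransChain H (suc k)
chain-cons {H} u (q , edge) u→q = q′ , edge′
  where
  q′ : Fin (suc _) → V H
  q′ F.zero    = u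
  q′ (F.suc i) = q i
  edge′ : ∀ i j → i F.< j → E H (q′ i) (q′ j)
  edge′ F.zero    (F.suc j) _         = u→q j
  edge′ (F.suc i) (F.suc j) (s≤s i<j) = edge i j i<j

T-loopless : ∀ n → Loopless (T n)
T-loopless _ = FP.<-irrefl refl

Mycielskian-loopless : ∀ {D} → Loopless D → Loopless (Mycielskian D)
Mycielskian-loopless loopless (e0i _ e) = loopless e

OrPower-loopless : ∀ {D t} → Loopless D → Loopless (OrPower D t)
OrPower-loopless loopless (_ , e) = loopless e

module _ {D : Digraph} where

  ++-edgeˡ : ∀ {t₁ t₂} {x₁ y₁ : Vector (V D) t₁} (x₂ y₂ : Vector (V D) t₂) →
             E (OrPower D t₁) x₁ y₁ → E (OrPower D (t₁ + t₂)) (x₁ ++ x₂) (y₁ ++ y₂)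
  ++-edgeˡ {t₂ = t₂} {x₁} {y₁} x₂ y₂ (l , e) =
    l ↑ˡ t₂ , subst₂ (E D) (sym (lookup-++ˡ x₁ x₂ l)) (sym (lookup-++ˡ y₁ y₂ l)) e

  ++-edgeʳ : ∀ {t₁ t₂} (x₁ y₁ : Vector (V D) t₁) {x₂ y₂ : Vector (V D) t₂} →
             E (OrPower D t₂) x₂ y₂ → E (OrPower D (t₁ + t₂)) (x₁ ++ x₂) (y₁ ++ y₂)
  ++-edgeʳ {t₁} x₁ y₁ {x₂} {y₂} (l , e) =
    t₁ ↑ʳ l , subst₂ (E D) (sym (lookup-++ʳ x₁ x₂ l)) (sym (lookup-++ʳ y₁ y₂ l)) e

  combine-<-lex : ∀ {k₁ k₂} (i₁ j₁ : Fin k₁) (i₂ j₂ : Fin k₂) → F.combine i₁ i₂ F.< F.combine j₁ j₂ →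
                  i₁ F.< j₁ ⊎ (i₁ ≡ j₁ × i₂ F.< j₂)
  combine-<-lex {k₁} {k₂} i₁ j₁ i₂ j₂ lt with FP.<-cmp i₁ j₁
  ... | tri< i₁<j₁ _ _ = inj₁ i₁<j₁
  ... | tri≈ _ refl _ = inj₂ (refl , +-cancelˡ-< (k₂ * toℕ i₁) _ _
                          (subst₂ _<_ (FP.toℕ-combine i₁ i₂) (FP.toℕ-combine i₁ j₂) lt))
  ... | tri> _ _ j₁<i₁ = ⊥-elim (<-asym lt (FP.combine-monoˡ-< j₂ i₂ j₁<i₁))

  orPower-lexProduct : ∀ {t₁ t₂ k₁ k₂} → TransChain (OrPower D t₁) k₁ → TransChain (OrPower D t₂) k₂ →
                       TransChain (OrPower D (t₁ + t₂)) (k₁ * k₂)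
  orPower-lexProduct {k₁ = k₁} {k₂} (q₁ , edge₁) (q₂ , edge₂) = q , edge
    where
    quot : Fin (k₁ * k₂) → Fin k₁
    quot = F.quotient k₂
    rem : Fin (k₁ * k₂) → Fin k₂
    rem = F.remainder {k₁} k₂
    q : Fin (k₁ * k₂) → Vector (V D) _
    q i = q₁ (quot i) ++ q₂ (rem i)
    edge : ∀ i j → i F.< j → E (OrPower D _) (q i) (q j)
    edge i j i<j with combine-<-lex (quot i) (quot j) (rem i) (rem j)
                        (subst₂ F._<_ (sym (FP.combine-remQuot {k₁} k₂ i)) (sym (FP.combine-remQuot {k₁} k₂ j)) i<j)
    ... | inj₁ lt          = ++-edgeˡ (q₂ (rem i)) (q₂ (rem j)) (edge₁ _ _ lt)
    ... | inj₂ (same , lt) = subst (λ x → E (OrPower D _) (q i) (q₁ x ++ q₂ (rem j))) same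
                               (++-edgeʳ (q₁ (quot i)) (q₁ (quot i)) (edge₂ _ _ lt))

  orPower-lexPower : ∀ {t k} → TransChain (OrPower D t) k → ∀ s → TransChain (OrPower D (s * t)) (k ^ s)
  orPower-lexPower Q zero    = (λ _ ()) , λ { F.zero F.zero () }
  orPower-lexPower Q (suc s) = orPower-lexProduct Q (orPower-lexPower Q s)

  orPower-pad : ∀ {t k} → V D → TransChain (OrPower D t) k → ∀ r → TransChain (OrPower D (t + r)) k
  orPower-pad v (q , edge) r = (λ i → q i ++ padding) , λ i j i<j → ++-edgeˡ padding padding (edge i j i<j)
    where
    padding : Vector (V D) r
    padding _ = v

  orPower-lexPower-padded : ∀ {k} n .{{_ : NonZero n}} → V D → TransChain (OrPower D n) k →
                            ∀ t → TransChain (OrPower D t) (k ^ (t / n))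
  orPower-lexPower-padded {k} n v Q t = subst (λ u → TransChain (OrPower D u) (k ^ (t / n))) [t/n]*n+t%n≡t
    (orPower-pad v (orPower-lexPower Q (t / n)) (t % n))
    where
    [t/n]*n+t%n≡t : (t / n) * n + t % n ≡ t
    [t/n]*n+t%n≡t = trans (+-comm _ (t % n)) (sym (m≡m%n+[m/n]*n t n))

CSpAtLeastRoot-fromChain : ∀ {H c} n .{{_ : NonZero n}} → Loopless H → V H → TransChain (OrPower H n) c →
                           CSpAtLeastRoot H c n
CSpAtLeastRoot-fromChain         _ _        _ _ _ zero    ()
CSpAtLeastRoot-fromChain {H} {c} n loopless v Q a (suc b) _ aⁿ<cbⁿ = suc K * n , λ t T₀≤t →
  c ^ (t / n) ,
  chain⇒transClique {OrPower H t} (OrPower-loopless {H} loopless) (orPower-lexPower-padded {H} n v Q t) ,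
  a^t≤c^[t/n]*b^t n aⁿ<cbⁿ (begin-strict
    K             <⟨ n<1+n K ⟩
    suc K         ≡⟨ m*n/n≡m (suc K) n ⟨
    suc K * n / n ≤⟨ /-monoˡ-≤ n T₀≤t ⟩
    t / n         ∎)
  where
  open ≤-Reasoning
  K : ℕ
  K = a ^ n * suc a ^ n

funToFin-cong : ∀ {m n} {f g : Fin m → Fin n} → (∀ i → f i ≡ g i) → F.funToFin f ≡ F.funToFin g
funToFin-cong {zero}  f≗g = refl
funToFin-cong {suc m} f≗g = cong₂ F.combine (f≗g F.zero) (funToFin-cong (f≗g ∘ F.suc))

finToFun-injective : ∀ {m n} {x y : Fin (m ^ n)} → (∀ i → F.finToFun x i ≡ F.finToFun y i) → x ≡ y
finToFun-injective {m} {n} {x} {y} x≗y =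
  trans (sym (FP.funToFin-finToFin {n} {m} x)) (trans (funToFin-cong {n} {m} x≗y) (FP.funToFin-finToFin {n} {m} y))

module MycielskianTournament (n : ℕ) .{{_ : NonZero n}} where

  Mⁿ : Digraph
  Mⁿ = OrPower (Mycielskian (T n)) n

  Tuple : Set
  Tuple = Fin n → Fin n

  weight : Tuple → ℕ
  weight p = sum (toℕ ∘ p)

  apex : Tuple → Fin n
  apex p = weight p mod n

  vertex : Tuple → Fin n → MV (T n)
  vertex p k = ⟨ p k , does (k FP.≟ apex p) ⟩

  -- The apex condition is needed because (v,1) → (w,1) is never an edge of M(T_n).
  Ascends : Tuple → Tuple → Fin n → Set
  Ascends p q k = p k F.< q k × (k ≢ apex p ⊎ k ≢ apex q)

  ascends? : ∀ p q k → Dec (Ascends p q k)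
  ascends? p q k = (p k FP.<? q k) ×-dec (¬? (k FP.≟ apex p) ⊎-dec ¬? (k FP.≟ apex q))

  ascends⇒edge : ∀ {p q k} → Ascends p q k → MEdge (T n) (vertex p k) (vertex q k)
  ascends⇒edge {p} {q} {k} (pk<qk , off-apex) with k FP.≟ apex p | k FP.≟ apex q
  ... | no _     | _        = e0i _ pk<qk
  ... | yes _    | no _     = e10 pk<qk
  ... | yes k≡ap | yes k≡aq = ⊥-elim ([ (λ k≢ap → k≢ap k≡ap) , (λ k≢aq → k≢aq k≡aq) ] off-apex)

  z→vertex : ∀ p → E Mⁿ (λ _ → z) (vertex p)
  z→vertex p = apex p , z→apex
    where
    z→apex : MEdge (T n) z (vertex p (apex p))
    z→apex with apex p FP.≟ apex p
    ... | yes _    = ez (p (apex p))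
    ... | no ap≢ap = ⊥-elim (ap≢ap refl)

  KeyOrder : DecTotalOrder _ _ _
  KeyOrder = ×-decTotalOrder ≤-decTotalOrder (Flip.decTotalOrder (FP.≤-decTotalOrder n))

  open DecTotalOrder KeyOrder using () renaming (_≤_ to _≤ₖ_)

  key : Tuple → ℕ × Fin n
  key p = weight p , p (apex p)

  key-≤⇒weight-≤ : ∀ {p q} → key p ≤ₖ key q → weight p ≤ weight q
  key-≤⇒weight-≤ (inj₁ (wp≤wq , _)) = wp≤wq
  key-≤⇒weight-≤ (inj₂ (wp≡wq , _)) = ≤-reflexive wp≡wq

  key-≤∧weight-≡⇒apex-≥ : ∀ {p q} → key p ≤ₖ key q → weight p ≡ weight q → q (apex q) F.≤ p (apex p)
  key-≤∧weight-≡⇒apex-≥ (inj₁ (_ , wp≢wq)) wp≡wq = ⊥-elim (wp≢wq wp≡wq)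
  key-≤∧weight-≡⇒apex-≥ (inj₂ (_ , qaq≤pap)) _  = qaq≤pap

  apex-≡⇒weight-%-≡ : ∀ {p q} → apex p ≡ apex q → weight p % n ≡ weight q % n
  apex-≡⇒weight-%-≡ {p} {q} ap≡aq =
    trans (sym (FP.toℕ-fromℕ< (m%n<n (weight p) n))) (trans (cong toℕ ap≡aq) (FP.toℕ-fromℕ< (m%n<n (weight q) n)))

  noAscent⇒≗ : ∀ {p q} → (∀ k → ¬ Ascends p q k) → key p ≤ₖ key q → ∀ k → p k ≡ q k
  noAscent⇒≗ {p} {q} noAscent p≤q = byApex (apex p FP.≟ apex q)
    where
    descends : ∀ k → k ≢ apex p ⊎ k ≢ apex q → q k F.≤ p k
    descends k off-apex = ≮⇒≥ λ pk<qk → noAscent k (pk<qk , off-apex)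
    wp≤wq : weight p ≤ weight q
    wp≤wq = key-≤⇒weight-≤ p≤q
    byApex : Dec (apex p ≡ apex q) → ∀ k → p k ≡ q k
    byApex (no ap≢aq) = ⊥-elim (ap≢aq (cong (_mod n) (≤-antisym wp≤wq (sum-mono-≤ λ k → descends k (off-apex k)))))
      where
      off-apex : ∀ k → k ≢ apex p ⊎ k ≢ apex q
      off-apex k with k FP.≟ apex p
      ... | yes k≡ap = inj₂ λ k≡aq → ap≢aq (trans (sym k≡ap) k≡aq)
      ... | no k≢ap  = inj₁ k≢ap
    byApex (yes ap≡aq) k = sym (FP.toℕ-injective (pointwise-≤∧sum-≥⇒≗ dominated (≤-reflexive wp≡wq) k))
      where
      j : Fin n
      j = apex p
      wq<wp+n : weight q < weight p + n
      wq<wp+n = begin-strict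
        weight q             ≤⟨ m≤m+n (weight q) _ ⟩
        weight q + toℕ (p j) ≤⟨ sum-mono-≤-except j (λ k k≢j → descends k (inj₁ k≢j)) ⟩
        weight p + toℕ (q j) <⟨ +-monoʳ-< (weight p) (FP.toℕ<n (q j)) ⟩
        weight p + n         ∎
        where open ≤-Reasoning
      wp≡wq : weight p ≡ weight q
      wp≡wq = ≡-mod⇒≡ n wp≤wq wq<wp+n (apex-≡⇒weight-%-≡ ap≡aq)
      qj≤pj : q j F.≤ p j
      qj≤pj = subst (λ k → q k F.≤ p j) (sym ap≡aq) (key-≤∧weight-≡⇒apex-≥ p≤q wp≡wq)
      dominated : ∀ k → toℕ (q k) ≤ toℕ (p k)
      dominated k with k FP.≟ j
      ... | yes refl = qj≤pj
      ... | no k≢j   = descends k (inj₁ k≢j)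

  ascent : ∀ {p q} → ¬ (∀ k → p k ≡ q k) → key p ≤ₖ key q → ∃ (Ascends p q)
  ascent {p} {q} p≢q p≤q with FP.any? (ascends? p q)
  ... | yes asc = asc
  ... | no ¬asc = ⊥-elim (p≢q (noAscent⇒≗ (λ k asc → ¬asc (k , asc)) p≤q))

  tupleChain : TransChain Mⁿ (n ^ n)
  tupleChain = vertex ∘ tuple , edge
    where
    open SortedEnumeration KeyOrder (key ∘ F.finToFun)
    tuple : Fin (n ^ n) → Tuple
    tuple = F.finToFun ∘ enumerate
    edge : ∀ i j → i F.< j → E Mⁿ (vertex (tuple i)) (vertex (tuple j))
    edge i j i<j with enumerate-sorted i<j
    ... | σi≢σj , key≤ with ascent (σi≢σj ∘ finToFun-injective) key≤
    ...   | k , asc = k , ascends⇒edge asc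

  mycielskianChain : TransChain Mⁿ (n ^ n + 1)
  mycielskianChain = subst (TransChain Mⁿ) (+-comm 1 (n ^ n))
    (chain-cons {Mⁿ} (λ _ → z) tupleChain λ _ → z→vertex _)

corollary2 : ∀ (n : ℕ) → 0 < n →
    CSpAtLeastRoot (Mycielskian (T n)) (n ^ n + 1) n × n ^ n < n ^ n + 1
corollary2 n@(suc _) _ =
  CSpAtLeastRoot-fromChain {Mycielskian (T n)} n (Mycielskian-loopless {T n} (T-loopless n)) z mycielskianChain ,
  m<m+n (n ^ n) z<s
  where open MycielskianTournament n
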